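{- For every $k\in\mathbb{N}$, with \[ F_{k,1}(q)=\sum_{n\ge 0}\frac{\left(q^{2n+2};q^2\right)_\infty\left(q^{2n+2k};q^2\right)_\infty}{\left(q^{2n+1};q^2\right)_\infty^2}\,q^{2n+1} \quad\text{and}\quad \omega(q)=\sum_{n\ge0}\frac{q^{2n(n+1)}}{\left(q;q^2\right)_{n+1}^2}, \] the coefficient of $q^m$ in $q\,\omega(q)-F_{k,1}(q)$ equals $0$ for every integer $m$ with $1\le m\le 2k$.
   Context: For $n\in\mathbb{N}_0\cup\{\infty\}$, $(a;q)_n:=\prod_{j=0}^{n-1}(1-aq^j)$. All series are formal power series in $q$. -}

module Defs where

open import Data.Nat using (ℕ; zero; suc; _∸_; _≤?_) renaming (_+_ to _+ℕ_; _*_ to _*ℕ_)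
open import Data.Integer using (ℤ; 0ℤ; 1ℤ; _+_; _*_; -_; _-_)
open import Relation.Nullary using (yes; no)

Series : Set
Series = ℕ → ℤ

sumBelow : ℕ → (ℕ → ℤ) → ℤ
sumBelow zero    f = 0ℤ
sumBelow (suc n) f = sumBelow n f + f n

coeff : Series → ℕ → ℤ
coeff f m = f m

one : Series
one zero    = 1ℤ
one (suc _) = 0ℤ

qpow : ℕ → Series
qpow e m with m Data.Nat.≟ e
... | yes _ = 1ℤ
... | no  _ = 0ℤ

_⊕_ : Series → Series → Series
(f ⊕ g) m = f m + g m

_⊖_ : Series → Series → Series
(f ⊖ g) m = f m - g m

_⊛_ : Series → Series → Series
(f ⊛ g) m = sumBelow (suc m) (λ i → f i * g (m ∸ i))

infixl 6 _⊕_ _⊖_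
infixl 7 _⊛_

pow : Series → ℕ → Series
pow f zero    = one
pow f (suc r) = f ⊛ pow f r

-- Multiplicative inverse of a series with constant term 1:
-- 1/f = Σ_{r ≥ 0} (1 - f)^r ; since (1 - f) has zero constant term,
-- (1-f)^r has order ≥ r, so only r ≤ m contribute to the coefficient of q^m.
inv : Series → Series
inv f m = sumBelow (suc m) (λ r → pow (one ⊖ f) r m)

prodBelow : ℕ → (ℕ → Series) → Series
prodBelow zero    s = one
prodBelow (suc n) s = prodBelow n s ⊛ s n

poch : ℕ → ℕ → ℕ → Series
poch a d n = prodBelow n (λ j → one ⊖ qpow (a +ℕ d *ℕ j))

-- infinite q-Pochhammer (q^a ; q^d)_∞ for d ≥ 1, as a formal power series:
-- the factors with j > m are ≡ 1 mod q^{m+1}, so the coefficient of q^m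
-- equals that of the finite product over j ≤ m.
pochInf : ℕ → ℕ → Series
pochInf a d m = poch a d (suc m) m

-- infinite sum Σ_{n≥0} t n of a family with ord (t n) > ... ≥ n,
-- so only n ≤ m contribute to the coefficient of q^m.
sumSeries : (ℕ → Series) → Series
sumSeries t m = sumBelow (suc m) (λ n → t n m)

F : ℕ → Series
F k = sumSeries (λ n →
        pochInf (2 *ℕ n +ℕ 2) 2 ⊛ pochInf (2 *ℕ n +ℕ 2 *ℕ k) 2
        ⊛ inv (pow (pochInf (2 *ℕ n +ℕ 1) 2) 2)
        ⊛ qpow (2 *ℕ n +ℕ 1))

ω : Series
ω = sumSeries (λ n →
      qpow (2 *ℕ n *ℕ (n +ℕ 1)) ⊛ inv (pow (poch 1 2 (n +ℕ 1)) 2))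

-- Write (a)ₙ for (qᵃ;q²)ₙ. Both
--   Ω s = Σₙ q^(n(2n+s+1)) / ((1)ₙ₊₁ (s)ₙ₊₁),          with ω = Ω 1, and
--   K s = Σₙ q²ⁿ (2n+2)_∞ / ((2n+1)_∞ (2n+s)_∞),       with F_{k,1} → q K 1 as k → ∞,
-- satisfy (1 - qˢ) X s = 1 + q X (s + 2) for s ≥ 1: in both cases (1 - qˢ) times the n-th term
-- of X s minus q times the n-th term of X (s + 2) is eₙ - eₙ₊₁ for a sequence with e₀ = 1 and
-- eₙ → 0 q-adically, so the sums telescope. As 1 - qˢ is invertible, the recurrence determines
-- X s modulo q^(c+1) from X (s + 2) modulo q^c; hence K = Ω. Finally, the n-th term of F_{k,1}
-- is q^(2n+1) times the n-th term of K 1 times (2n+2k)_∞ ≡ 1 (mod q^(2n+2k)), so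
-- F_{k,1} ≡ q K 1 = q ω (mod q^(2k+1)).

module Submission where

open import Defs
open import Data.Nat using (ℕ; zero; suc; _∸_; _≤_; _<_; z≤n; s≤s)
import Data.Nat.Properties as ℕₚ
open import Data.Integer as ℤ using (ℤ; 0ℤ; 1ℤ)
import Data.Integer.Properties as ℤₚ
open import Data.Sum using (inj₁; inj₂)
open import Function using (_∘_)
open import Relation.Binary.PropositionalEquality

module FormalPowerSeries where

  open import Data.Nat using (_≟_; _<?_) renaming (_+_ to _+ℕ_)
  open import Data.Integer using (_+_; _*_; -_; _-_)
  import Data.Maybe as Maybe
  open import Relation.Nullary using (Dec; yes; no; contradiction)
  open import Relation.Binary.Bundles using (Setoid)
  open import Relation.Binary.Definitions using (WeaklyDecidable)
  open import Relation.Binary.Consequences using (dec⇒weaklyDec)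
  open import Algebra.Bundles using (CommutativeRing)
  open import Algebra.Structures using (IsCommutativeRing)
  open import Algebra.Properties.CommutativeSemigroup ℤₚ.+-commutativeSemigroup using (interchange)
  import Algebra.Solver.Ring.AlmostCommutativeRing as ACR
  import Algebra.Solver.Ring
  import Relation.Binary.Reasoning.Setoid as SetoidReasoning
  open import Data.Product using (_,_)

  sumBelow-cong : ∀ n {f g : ℕ → ℤ} → (∀ i → i < n → f i ≡ g i) → sumBelow n f ≡ sumBelow n g
  sumBelow-cong zero    f≡g = refl
  sumBelow-cong (suc n) f≡g =
    cong₂ _+_ (sumBelow-cong n (λ i i<n → f≡g i (ℕₚ.m<n⇒m<1+n i<n))) (f≡g n ℕₚ.≤-refl)

  sumBelow-zero : ∀ n {f : ℕ → ℤ} → (∀ i → i < n → f i ≡ 0ℤ) → sumBelow n f ≡ 0ℤ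
  sumBelow-zero zero    f≡0 = refl
  sumBelow-zero (suc n) f≡0 =
    cong₂ _+_ (sumBelow-zero n (λ i i<n → f≡0 i (ℕₚ.m<n⇒m<1+n i<n))) (f≡0 n ℕₚ.≤-refl)

  sumBelow-+ : ∀ n (f g : ℕ → ℤ) → sumBelow n (λ i → f i + g i) ≡ sumBelow n f + sumBelow n g
  sumBelow-+ zero    f g = refl
  sumBelow-+ (suc n) f g = trans (cong (_+ (f n + g n)) (sumBelow-+ n f g))
                                 (interchange (sumBelow n f) (sumBelow n g) (f n) (g n))

  sumBelow-neg : ∀ n (f : ℕ → ℤ) → sumBelow n (λ i → - f i) ≡ - sumBelow n f
  sumBelow-neg zero    f = refl
  sumBelow-neg (suc n) f = trans (cong (_+ - f n) (sumBelow-neg n f))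
                                 (sym (ℤₚ.neg-distrib-+ (sumBelow n f) (f n)))

  sumBelow-- : ∀ n (f g : ℕ → ℤ) → sumBelow n (λ i → f i - g i) ≡ sumBelow n f - sumBelow n g
  sumBelow-- n f g = trans (sumBelow-+ n f (-_ ∘ g)) (cong (sumBelow n f +_) (sumBelow-neg n g))

  sumBelow-*ˡ : ∀ n c (f : ℕ → ℤ) → c * sumBelow n f ≡ sumBelow n (λ i → c * f i)
  sumBelow-*ˡ zero    c f = ℤₚ.*-zeroʳ c
  sumBelow-*ˡ (suc n) c f = trans (ℤₚ.*-distribˡ-+ c (sumBelow n f) (f n))
                                  (cong (_+ c * f n) (sumBelow-*ˡ n c f))

  sumBelow-*ʳ : ∀ n c (f : ℕ → ℤ) → sumBelow n f * c ≡ sumBelow n (λ i → f i * c)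
  sumBelow-*ʳ n c f = begin
    sumBelow n f * c               ≡⟨ ℤₚ.*-comm (sumBelow n f) c ⟩
    c * sumBelow n f               ≡⟨ sumBelow-*ˡ n c f ⟩
    sumBelow n (λ i → c * f i)     ≡⟨ sumBelow-cong n (λ i _ → ℤₚ.*-comm c (f i)) ⟩
    sumBelow n (λ i → f i * c)     ∎
    where open ≡-Reasoning

  sumBelow-suc : ∀ n (f : ℕ → ℤ) → sumBelow (suc n) f ≡ f 0 + sumBelow n (f ∘ suc)
  sumBelow-suc zero    f = trans (ℤₚ.+-identityˡ (f 0)) (sym (ℤₚ.+-identityʳ (f 0)))
  sumBelow-suc (suc n) f = trans (cong (_+ f (suc n)) (sumBelow-suc n f)) (ℤₚ.+-assoc (f 0) _ _)

  sumBelow-swap : ∀ n k (F : ℕ → ℕ → ℤ) →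
                  sumBelow n (λ i → sumBelow k (F i)) ≡ sumBelow k (λ j → sumBelow n (λ i → F i j))
  sumBelow-swap zero    k F = sym (sumBelow-zero k (λ _ _ → refl))
  sumBelow-swap (suc n) k F = trans (cong (_+ sumBelow k (F n)) (sumBelow-swap n k F))
                                    (sym (sumBelow-+ k (λ j → sumBelow n (λ i → F i j)) (F n)))

  sumBelow-reverse : ∀ n (f : ℕ → ℤ) → sumBelow n f ≡ sumBelow n (λ i → f (n ∸ suc i))
  sumBelow-reverse zero    f = refl
  sumBelow-reverse (suc n) f = begin
    sumBelow n f + f n                            ≡⟨ cong (_+ f n) (sumBelow-reverse n f) ⟩
    sumBelow n (λ i → f (n ∸ suc i)) + f n        ≡⟨ ℤₚ.+-comm _ (f n) ⟩
    f n + sumBelow n (λ i → f (n ∸ suc i))        ≡⟨ sumBelow-suc n (λ i → f (suc n ∸ suc i)) ⟨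
    sumBelow (suc n) (λ i → f (suc n ∸ suc i))    ∎
    where open ≡-Reasoning

  sumBelow-extend : ∀ {n N} (f : ℕ → ℤ) → n ≤ N → (∀ i → n ≤ i → i < N → f i ≡ 0ℤ) →
                    sumBelow N f ≡ sumBelow n f
  sumBelow-extend {N = zero}  f z≤n _ = refl
  sumBelow-extend {n} {suc N} f n≤N+1 f≡0 with ℕₚ.m≤n⇒m<n∨m≡n n≤N+1
  ... | inj₂ refl       = refl
  ... | inj₁ (s≤s n≤N) = begin
    sumBelow N f + f N  ≡⟨ cong₂ _+_ (sumBelow-extend f n≤N (λ i n≤i i<N → f≡0 i n≤i (ℕₚ.m<n⇒m<1+n i<N)))
                                     (f≡0 N n≤N ℕₚ.≤-refl) ⟩
    sumBelow n f + 0ℤ   ≡⟨ ℤₚ.+-identityʳ (sumBelow n f) ⟩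
    sumBelow n f        ∎
    where open ≡-Reasoning

  sumBelow-single : ∀ n (f : ℕ → ℤ) e → e < n → (∀ i → i < n → i ≢ e → f i ≡ 0ℤ) → sumBelow n f ≡ f e
  sumBelow-single (suc n) f e e<n+1 f≡0 with e ≟ n
  ... | yes refl = trans (cong (_+ f e) (sumBelow-zero n (λ i i<n → f≡0 i (ℕₚ.m<n⇒m<1+n i<n) (ℕₚ.<⇒≢ i<n))))
                         (ℤₚ.+-identityˡ (f e))
  ... | no e≢n   = trans (cong₂ _+_ (sumBelow-single n f e (ℕₚ.≤∧≢⇒< (ℕₚ.≤-pred e<n+1) e≢n)
                                      (λ i i<n → f≡0 i (ℕₚ.m<n⇒m<1+n i<n)))
                                    (f≡0 n ℕₚ.≤-refl (e≢n ∘ sym)))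
                         (ℤₚ.+-identityʳ (f e))

  sumBelow-triangle : ∀ n (F : ℕ → ℕ → ℤ) →
    sumBelow n (λ i → sumBelow (suc i) (F i)) ≡ sumBelow n (λ j → sumBelow (n ∸ j) (λ l → F (j +ℕ l) j))
  sumBelow-triangle zero    F = refl
  sumBelow-triangle (suc n) F = begin
    sumBelow n (λ i → sumBelow (suc i) (F i)) + sumBelow (suc n) (F n)
      ≡⟨ cong (_+ sumBelow (suc n) (F n)) (sumBelow-triangle n F) ⟩
    sumBelow n column + sumBelow (suc n) (F n)
      ≡⟨ cong (_+ sumBelow (suc n) (F n)) column-last ⟨
    sumBelow (suc n) column + sumBelow (suc n) (F n)
      ≡⟨ sumBelow-+ (suc n) column (F n) ⟨
    sumBelow (suc n) (λ j → column j + F n j)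
      ≡⟨ sumBelow-cong (suc n) (λ j j≤n → cong (λ i → column j + F i j) (sym (ℕₚ.m+[n∸m]≡n (ℕₚ.≤-pred j≤n)))) ⟩
    sumBelow (suc n) (λ j → sumBelow (suc (n ∸ j)) (λ l → F (j +ℕ l) j))
      ≡⟨ sumBelow-cong (suc n) (λ j j≤n → cong (λ k → sumBelow k (λ l → F (j +ℕ l) j))
                                                (sym (ℕₚ.+-∸-assoc 1 (ℕₚ.≤-pred j≤n)))) ⟩
    sumBelow (suc n) (λ j → sumBelow (suc n ∸ j) (λ l → F (j +ℕ l) j)) ∎
    where
    open ≡-Reasoning
    column : ℕ → ℤ
    column j = sumBelow (n ∸ j) (λ l → F (j +ℕ l) j)
    column-last : sumBelow (suc n) column ≡ sumBelow n column
    column-last = trans (cong (λ k → sumBelow n column + sumBelow k (λ l → F (n +ℕ l) n)) (ℕₚ.n∸n≡0 n))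
                        (ℤₚ.+-identityʳ (sumBelow n column))

  sumBelow-telescope : ∀ N (a : ℕ → ℤ) → sumBelow N (λ n → a n - a (suc n)) ≡ a 0 - a N
  sumBelow-telescope zero    a = sym (ℤₚ.+-inverseʳ (a 0))
  sumBelow-telescope (suc N) a = trans (cong (_+ (a N - a (suc N))) (sumBelow-telescope N a))
                                       (ℤₚ.+-minus-telescope (a 0) (a N) (a (suc N)))

  -- The ring of formal power series

  𝟘 : Series
  𝟘 _ = 0ℤ

  neg : Series → Series
  neg f m = - f m

  ≗-refl : ∀ {f : Series} → f ≗ f
  ≗-refl _ = refl

  ≗-sym : ∀ {f g : Series} → f ≗ g → g ≗ f
  ≗-sym f≗g m = sym (f≗g m)

  ≗-trans : ∀ {f g h : Series} → f ≗ g → g ≗ h → f ≗ h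
  ≗-trans f≗g g≗h m = trans (f≗g m) (g≗h m)

  ⊕-cong : ∀ {f f′ g g′} → f ≗ f′ → g ≗ g′ → f ⊕ g ≗ f′ ⊕ g′
  ⊕-cong f≗f′ g≗g′ m = cong₂ _+_ (f≗f′ m) (g≗g′ m)

  ⊖-cong : ∀ {f f′ g g′} → f ≗ f′ → g ≗ g′ → f ⊖ g ≗ f′ ⊖ g′
  ⊖-cong f≗f′ g≗g′ m = cong₂ _-_ (f≗f′ m) (g≗g′ m)

  ⊛-cong : ∀ {f f′ g g′} → f ≗ f′ → g ≗ g′ → f ⊛ g ≗ f′ ⊛ g′
  ⊛-cong f≗f′ g≗g′ m = sumBelow-cong (suc m) (λ i _ → cong₂ _*_ (f≗f′ i) (g≗g′ (m ∸ i)))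

  ⊛-congˡ : ∀ f {g g′} → g ≗ g′ → f ⊛ g ≗ f ⊛ g′
  ⊛-congˡ f = ⊛-cong {f} ≗-refl

  ⊛-congʳ : ∀ h {f f′} → f ≗ f′ → f ⊛ h ≗ f′ ⊛ h
  ⊛-congʳ h f≗f′ = ⊛-cong f≗f′ (≗-refl {h})

  ⊛-comm : ∀ f g → f ⊛ g ≗ g ⊛ f
  ⊛-comm f g m = begin
    sumBelow (suc m) (λ i → f i * g (m ∸ i))              ≡⟨ sumBelow-reverse (suc m) _ ⟩
    sumBelow (suc m) (λ i → f (m ∸ i) * g (m ∸ (m ∸ i)))  ≡⟨ sumBelow-cong (suc m) swap ⟩
    sumBelow (suc m) (λ i → g i * f (m ∸ i))              ∎
    where
    open ≡-Reasoning
    swap : ∀ i → i < suc m → f (m ∸ i) * g (m ∸ (m ∸ i)) ≡ g i * f (m ∸ i)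
    swap i i≤m = trans (cong (λ j → f (m ∸ i) * g j) (ℕₚ.m∸[m∸n]≡n (ℕₚ.≤-pred i≤m)))
                       (ℤₚ.*-comm (f (m ∸ i)) (g i))

  ⊛-assoc : ∀ f g h → (f ⊛ g) ⊛ h ≗ f ⊛ (g ⊛ h)
  ⊛-assoc f g h m = begin
    sumBelow (suc m) (λ i → sumBelow (suc i) (λ j → f j * g (i ∸ j)) * h (m ∸ i))
      ≡⟨ sumBelow-cong (suc m) (λ i _ → sumBelow-*ʳ (suc i) (h (m ∸ i)) _) ⟩
    sumBelow (suc m) (λ i → sumBelow (suc i) (λ j → f j * g (i ∸ j) * h (m ∸ i)))
      ≡⟨ sumBelow-triangle (suc m) (λ i j → f j * g (i ∸ j) * h (m ∸ i)) ⟩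
    sumBelow (suc m) (λ j → sumBelow (suc m ∸ j) (λ l → f j * g (j +ℕ l ∸ j) * h (m ∸ (j +ℕ l))))
      ≡⟨ sumBelow-cong (suc m) reindex ⟩
    sumBelow (suc m) (λ j → sumBelow (suc (m ∸ j)) (λ l → f j * (g l * h (m ∸ j ∸ l))))
      ≡⟨ sumBelow-cong (suc m) (λ j _ → sumBelow-*ˡ (suc (m ∸ j)) (f j) _) ⟨
    sumBelow (suc m) (λ j → f j * sumBelow (suc (m ∸ j)) (λ l → g l * h (m ∸ j ∸ l)))
      ∎
    where
    open ≡-Reasoning
    reindex : ∀ j → j < suc m →
      sumBelow (suc m ∸ j) (λ l → f j * g (j +ℕ l ∸ j) * h (m ∸ (j +ℕ l))) ≡
      sumBelow (suc (m ∸ j)) (λ l → f j * (g l * h (m ∸ j ∸ l)))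
    reindex j j≤m = begin
      sumBelow (suc m ∸ j) _     ≡⟨ cong (λ k → sumBelow k (λ l → f j * g (j +ℕ l ∸ j) * h (m ∸ (j +ℕ l))))
                                         (ℕₚ.+-∸-assoc 1 (ℕₚ.≤-pred j≤m)) ⟩
      sumBelow (suc (m ∸ j)) _   ≡⟨ sumBelow-cong (suc (m ∸ j)) (λ l _ → trans
                                      (cong₂ (λ a b → f j * g a * h b) (ℕₚ.m+n∸m≡n j l) (sym (ℕₚ.∸-+-assoc m j l)))
                                      (ℤₚ.*-assoc (f j) (g l) (h (m ∸ j ∸ l)))) ⟩
      sumBelow (suc (m ∸ j)) _   ∎

  ⊛-distribˡ : ∀ f g h → f ⊛ (g ⊕ h) ≗ f ⊛ g ⊕ f ⊛ h
  ⊛-distribˡ f g h m = trans (sumBelow-cong (suc m) (λ i _ → ℤₚ.*-distribˡ-+ (f i) (g (m ∸ i)) (h (m ∸ i))))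
                             (sumBelow-+ (suc m) _ _)

  ⊛-distribʳ : ∀ f g h → (g ⊕ h) ⊛ f ≗ g ⊛ f ⊕ h ⊛ f
  ⊛-distribʳ f g h = ≗-trans (⊛-comm (g ⊕ h) f)
                             (≗-trans (⊛-distribˡ f g h) (⊕-cong (⊛-comm f g) (⊛-comm f h)))

  ⊛-identityˡ : ∀ f → one ⊛ f ≗ f
  ⊛-identityˡ f m = begin
    sumBelow (suc m) (λ i → one i * f (m ∸ i))               ≡⟨ sumBelow-suc m _ ⟩
    1ℤ * f m + sumBelow m (λ i → 0ℤ * f (m ∸ suc i))         ≡⟨ cong₂ _+_ (ℤₚ.*-identityˡ (f m))
                                                                         (sumBelow-zero m (λ _ _ → refl)) ⟩
    f m + 0ℤ                                                  ≡⟨ ℤₚ.+-identityʳ (f m) ⟩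
    f m                                                       ∎
    where open ≡-Reasoning

  ⊛-identityʳ : ∀ f → f ⊛ one ≗ f
  ⊛-identityʳ f = ≗-trans (⊛-comm f one) (⊛-identityˡ f)

  ⊛-zeroˡ : ∀ f → 𝟘 ⊛ f ≗ 𝟘
  ⊛-zeroˡ f m = sumBelow-zero (suc m) (λ _ _ → refl)

  isCommutativeRing : IsCommutativeRing _≗_ _⊕_ _⊛_ neg 𝟘 one
  isCommutativeRing = record
    { isRing = record
      { +-isAbelianGroup = record
        { isGroup = record
          { isMonoid = record
            { isSemigroup = record
              { isMagma = record
                { isEquivalence = record { refl = ≗-refl ; sym = ≗-sym ; trans = ≗-trans }
                ; ∙-cong = ⊕-cong }
              ; assoc = λ f g h m → ℤₚ.+-assoc (f m) (g m) (h m) }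
            ; identity = (λ f m → ℤₚ.+-identityˡ (f m)) , (λ f m → ℤₚ.+-identityʳ (f m)) }
          ; inverse = (λ f m → ℤₚ.+-inverseˡ (f m)) , (λ f m → ℤₚ.+-inverseʳ (f m))
          ; ⁻¹-cong = λ f≗g m → cong -_ (f≗g m) }
        ; comm = λ f g m → ℤₚ.+-comm (f m) (g m) }
      ; *-cong = ⊛-cong
      ; *-assoc = ⊛-assoc
      ; *-identity = ⊛-identityˡ , ⊛-identityʳ
      ; distrib = ⊛-distribˡ , ⊛-distribʳ }
    ; *-comm = ⊛-comm }

  seriesRing : CommutativeRing _ _
  seriesRing = record { isCommutativeRing = isCommutativeRing }

  module ≗-Reasoning = SetoidReasoning (CommutativeRing.setoid seriesRing)

  scalar : ℤ → Series
  scalar c zero    = c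
  scalar c (suc _) = 0ℤ

  -- The ring solver interprets its constant 1 as `constant 1ℤ`; the special case makes
  -- that definitionally `one`, so solved equations can be used on goals mentioning `one`.
  constant : ℤ → Series
  constant (ℤ.+ 1) = one
  constant c       = scalar c

  constant≗scalar : ∀ c → constant c ≗ scalar c
  constant≗scalar (ℤ.+ 0)           _       = refl
  constant≗scalar (ℤ.+ 1)           zero    = refl
  constant≗scalar (ℤ.+ 1)           (suc _) = refl
  constant≗scalar (ℤ.+ suc (suc _)) _       = refl
  constant≗scalar ℤ.-[1+ _ ]        _       = refl

  scalar-* : ∀ a b → scalar (a * b) ≗ scalar a ⊛ scalar b
  scalar-* a b zero    = sym (ℤₚ.+-identityˡ (a * b))
  scalar-* a b (suc m) = sym (sumBelow-zero (suc (suc m)) vanish)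
    where
    vanish : ∀ i → i < suc (suc m) → scalar a i * scalar b (suc m ∸ i) ≡ 0ℤ
    vanish zero    _ = ℤₚ.*-zeroʳ a
    vanish (suc i) _ = refl

  constant-morphism : ACR._-Raw-AlmostCommutative⟶_ (CommutativeRing.rawRing ℤₚ.+-*-commutativeRing)
                                                     (ACR.fromCommutativeRing seriesRing)
  constant-morphism = record
    { ⟦_⟧    = constant
    ; +-homo = λ a b → via-scalar (scalar-+ a b) (⊕-cong (constant≗scalar a) (constant≗scalar b))
    ; *-homo = λ a b → via-scalar (scalar-* a b) (⊛-cong (constant≗scalar a) (constant≗scalar b))
    ; -‿homo = λ a → via-scalar (scalar-neg a) (λ m → cong -_ (constant≗scalar a m))
    ; 0-homo = scalar-0
    ; 1-homo = ≗-refl }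
    where
    via-scalar : ∀ {c f g} → scalar c ≗ f → g ≗ f → constant c ≗ g
    via-scalar {c} s≗f g≗f = ≗-trans (constant≗scalar c) (≗-trans s≗f (≗-sym g≗f))
    scalar-+ : ∀ a b → scalar (a + b) ≗ scalar a ⊕ scalar b
    scalar-+ a b zero    = refl
    scalar-+ a b (suc _) = refl
    scalar-0 : scalar 0ℤ ≗ 𝟘
    scalar-0 zero    = refl
    scalar-0 (suc _) = refl
    scalar-neg : ∀ a → scalar (- a) ≗ neg (scalar a)
    scalar-neg a zero    = refl
    scalar-neg a (suc _) = refl

  constant-≟ : WeaklyDecidable (λ a b → constant a ≗ constant b)
  constant-≟ a b = Maybe.map (λ a≡b → cong-app (cong constant a≡b)) (dec⇒weaklyDec ℤₚ._≟_ a b)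

  module Solver = Algebra.Solver.Ring (CommutativeRing.rawRing ℤₚ.+-*-commutativeRing)
                                      (ACR.fromCommutativeRing seriesRing) constant-morphism constant-≟
  open Solver public using (solve; _:=_; _:+_; _:-_; _:*_)

  I : ∀ {n} → Solver.Polynomial n
  I = Solver.con 1ℤ

  -- Congruences modulo powers of q

  infix 4 _≗[_]_

  -- f ≗[ a ] g  says  f ≡ g (mod q^a).
  _≗[_]_ : Series → ℕ → Series → Set
  f ≗[ a ] g = ∀ m → m < a → f m ≡ g m

  ≗⇒≗[] : ∀ {f g} a → f ≗ g → f ≗[ a ] g
  ≗⇒≗[] a f≗g m _ = f≗g m

  ≗[]⇒≗ : ∀ {f g} → (∀ a → f ≗[ a ] g) → f ≗ g
  ≗[]⇒≗ f≗[]g m = f≗[]g (suc m) m ℕₚ.≤-refl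

  ≗[]-weaken : ∀ {f g a b} → a ≤ b → f ≗[ b ] g → f ≗[ a ] g
  ≗[]-weaken a≤b f≗g m m<a = f≗g m (ℕₚ.<-≤-trans m<a a≤b)

  ≗[]-refl : ∀ f {a} → f ≗[ a ] f
  ≗[]-refl f _ _ = refl

  ≗[]-sym : ∀ {f g a} → f ≗[ a ] g → g ≗[ a ] f
  ≗[]-sym f≗g m m<a = sym (f≗g m m<a)

  ≗[]-trans : ∀ {f g h a} → f ≗[ a ] g → g ≗[ a ] h → f ≗[ a ] h
  ≗[]-trans f≗g g≗h m m<a = trans (f≗g m m<a) (g≗h m m<a)

  ≗[]-setoid : ℕ → Setoid _ _
  ≗[]-setoid a = record
    { Carrier       = Series
    ; _≈_           = _≗[ a ]_
    ; isEquivalence = record { refl = λ {f} → ≗[]-refl f ; sym = ≗[]-sym ; trans = ≗[]-trans } }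

  module ≗[]-Reasoning a = SetoidReasoning (≗[]-setoid a)

  ⊕-local : ∀ {f f′ g g′ a} → f ≗[ a ] f′ → g ≗[ a ] g′ → f ⊕ g ≗[ a ] f′ ⊕ g′
  ⊕-local f≗f′ g≗g′ m m<a = cong₂ _+_ (f≗f′ m m<a) (g≗g′ m m<a)

  ⊖-local : ∀ {f f′ g g′ a} → f ≗[ a ] f′ → g ≗[ a ] g′ → f ⊖ g ≗[ a ] f′ ⊖ g′
  ⊖-local f≗f′ g≗g′ m m<a = cong₂ _-_ (f≗f′ m m<a) (g≗g′ m m<a)

  ⊛-local : ∀ {f f′ g g′ a} → f ≗[ a ] f′ → g ≗[ a ] g′ → f ⊛ g ≗[ a ] f′ ⊛ g′
  ⊛-local f≗f′ g≗g′ m m<a = sumBelow-cong (suc m) (λ i i≤m →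
    cong₂ _*_ (f≗f′ i (ℕₚ.≤-<-trans (ℕₚ.≤-pred i≤m) m<a)) (g≗g′ (m ∸ i) (ℕₚ.≤-<-trans (ℕₚ.m∸n≤m m i) m<a)))

  ⊛-≗[]oneʳ : ∀ g {f a} → f ≗[ a ] one → g ⊛ f ≗[ a ] g
  ⊛-≗[]oneʳ g {a = a} f≗1 = ≗[]-trans (⊛-local (≗[]-refl g) f≗1) (≗⇒≗[] a (⊛-identityʳ g))

  qpow-self : ∀ e → qpow e e ≡ 1ℤ
  qpow-self e with e ≟ e
  ... | yes _  = refl
  ... | no e≢e = contradiction refl e≢e

  qpow-other : ∀ {e m} → m ≢ e → qpow e m ≡ 0ℤ
  qpow-other {e} {m} m≢e with m ≟ e
  ... | yes m≡e = contradiction m≡e m≢e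
  ... | no _    = refl

  qpow-⊛-≥ : ∀ e f {m} → e ≤ m → (qpow e ⊛ f) m ≡ f (m ∸ e)
  qpow-⊛-≥ e f {m} e≤m = begin
    sumBelow (suc m) (λ i → qpow e i * f (m ∸ i))  ≡⟨ sumBelow-single (suc m) _ e (s≤s e≤m) vanish ⟩
    qpow e e * f (m ∸ e)                           ≡⟨ cong (_* f (m ∸ e)) (qpow-self e) ⟩
    1ℤ * f (m ∸ e)                                 ≡⟨ ℤₚ.*-identityˡ (f (m ∸ e)) ⟩
    f (m ∸ e)                                      ∎
    where
    open ≡-Reasoning
    vanish : ∀ i → i < suc m → i ≢ e → qpow e i * f (m ∸ i) ≡ 0ℤ
    vanish i _ i≢e = cong (_* f (m ∸ i)) (qpow-other i≢e)

  qpow-⊛-< : ∀ e f {m} → m < e → (qpow e ⊛ f) m ≡ 0ℤ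
  qpow-⊛-< e f {m} m<e = sumBelow-zero (suc m) (λ i i≤m →
    cong (_* f (m ∸ i)) (qpow-other (ℕₚ.<⇒≢ (ℕₚ.≤-<-trans (ℕₚ.≤-pred i≤m) m<e))))

  qpow-⊛-order : ∀ e f → qpow e ⊛ f ≗[ e ] 𝟘
  qpow-⊛-order e f m = qpow-⊛-< e f

  qpow-⊛-local : ∀ e {f g a} → f ≗[ a ] g → qpow e ⊛ f ≗[ e +ℕ a ] qpow e ⊛ g
  qpow-⊛-local e {f} {g} {a} f≗g m m<e+a with m <? e
  ... | yes m<e = trans (qpow-⊛-< e f m<e) (sym (qpow-⊛-< e g m<e))
  ... | no m≮e  = begin
    (qpow e ⊛ f) m  ≡⟨ qpow-⊛-≥ e f e≤m ⟩
    f (m ∸ e)       ≡⟨ f≗g (m ∸ e) m∸e<a ⟩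
    g (m ∸ e)       ≡⟨ qpow-⊛-≥ e g e≤m ⟨
    (qpow e ⊛ g) m  ∎
    where
    open ≡-Reasoning
    e≤m : e ≤ m
    e≤m = ℕₚ.≮⇒≥ m≮e
    m∸e<a : m ∸ e < a
    m∸e<a = subst (m ∸ e <_) (ℕₚ.m+n∸m≡n e a) (ℕₚ.∸-monoˡ-< m<e+a e≤m)

  qpow-shift : ∀ a b n → qpow (a +ℕ b) (a +ℕ n) ≡ qpow b n
  qpow-shift a b n = by-cases (n ≟ b)
    where
    by-cases : Dec (n ≡ b) → qpow (a +ℕ b) (a +ℕ n) ≡ qpow b n
    by-cases (yes refl) = trans (qpow-self (a +ℕ n)) (sym (qpow-self n))
    by-cases (no n≢b)   = trans (qpow-other (n≢b ∘ ℕₚ.+-cancelˡ-≡ a n b)) (sym (qpow-other n≢b))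

  qpow-+ : ∀ a b → qpow a ⊛ qpow b ≗ qpow (a +ℕ b)
  qpow-+ a b m with m <? a
  ... | yes m<a = trans (qpow-⊛-< a (qpow b) m<a)
                        (sym (qpow-other (ℕₚ.<⇒≢ (ℕₚ.<-≤-trans m<a (ℕₚ.m≤m+n a b)))))
  ... | no m≮a  = begin
    (qpow a ⊛ qpow b) m         ≡⟨ qpow-⊛-≥ a (qpow b) a≤m ⟩
    qpow b (m ∸ a)              ≡⟨ qpow-shift a b (m ∸ a) ⟨
    qpow (a +ℕ b) (a +ℕ (m ∸ a)) ≡⟨ cong (qpow (a +ℕ b)) (ℕₚ.m+[n∸m]≡n a≤m) ⟩
    qpow (a +ℕ b) m             ∎
    where
    open ≡-Reasoning
    a≤m : a ≤ m
    a≤m = ℕₚ.≮⇒≥ m≮a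

  qpow-0 : qpow 0 ≗ one
  qpow-0 zero    = refl
  qpow-0 (suc _) = refl

  one⊖qpow≗[]one : ∀ e → one ⊖ qpow e ≗[ e ] one
  one⊖qpow≗[]one e m m<e = trans (cong (λ x → one m - x) (qpow-other (ℕₚ.<⇒≢ m<e))) (ℤₚ.+-identityʳ (one m))

  ⊛-order : ∀ {f g a b} → f ≗[ a ] 𝟘 → g ≗[ b ] 𝟘 → f ⊛ g ≗[ a +ℕ b ] 𝟘
  ⊛-order {f} {g} {a} {b} f≗0 g≗0 m m<a+b = sumBelow-zero (suc m) vanish
    where
    vanish : ∀ i → i < suc m → f i * g (m ∸ i) ≡ 0ℤ
    vanish i i≤m with i <? a
    ... | yes i<a = cong (_* g (m ∸ i)) (f≗0 i i<a)
    ... | no i≮a  = trans (cong (f i *_) (g≗0 (m ∸ i) m∸i<b)) (ℤₚ.*-zeroʳ (f i))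
      where
      m∸i<b : m ∸ i < b
      m∸i<b = ℕₚ.+-cancelˡ-< i (m ∸ i) b
                (subst (_< i +ℕ b) (sym (ℕₚ.m+[n∸m]≡n (ℕₚ.≤-pred i≤m)))
                       (ℕₚ.<-≤-trans m<a+b (ℕₚ.+-monoˡ-≤ b (ℕₚ.≮⇒≥ i≮a))))

  pow-local : ∀ {f g a} r → f ≗[ a ] g → pow f r ≗[ a ] pow g r
  pow-local zero    _   _ _ = refl
  pow-local (suc r) f≗g     = ⊛-local f≗g (pow-local r f≗g)

  pow-order : ∀ {g} → g ≗[ 1 ] 𝟘 → ∀ r → pow g r ≗[ r ] 𝟘
  pow-order g≗0 zero    _ ()
  pow-order g≗0 (suc r) = ⊛-order g≗0 (pow-order g≗0 r)

  geometric : Series → ℕ → Series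
  geometric g N m = sumBelow N (λ r → pow g r m)

  geometric-telescope : ∀ g N → (one ⊖ g) ⊛ geometric g N ≗ one ⊖ pow g N
  geometric-telescope g zero = begin
    (one ⊖ g) ⊛ 𝟘  ≈⟨ ⊛-comm (one ⊖ g) 𝟘 ⟩
    𝟘 ⊛ (one ⊖ g)  ≈⟨ ⊛-zeroˡ (one ⊖ g) ⟩
    𝟘              ≈⟨ (λ m → ℤₚ.+-inverseʳ (one m)) ⟨
    one ⊖ one      ∎
    where open ≗-Reasoning
  geometric-telescope g (suc N) = begin
    (one ⊖ g) ⊛ (geometric g N ⊕ pow g N)               ≈⟨ ⊛-distribˡ (one ⊖ g) (geometric g N) (pow g N) ⟩
    (one ⊖ g) ⊛ geometric g N ⊕ (one ⊖ g) ⊛ pow g N     ≈⟨ ⊕-cong (geometric-telescope g N) ≗-refl ⟩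
    (one ⊖ pow g N) ⊕ (one ⊖ g) ⊛ pow g N               ≈⟨ solve 2 (λ g p → (I :- p) :+ (I :- g) :* p := I :- g :* p)
                                                               ≗-refl g (pow g N) ⟩
    one ⊖ g ⊛ pow g N                                   ∎
    where open ≗-Reasoning

  inv-inverseʳ : ∀ f → f 0 ≡ 1ℤ → f ⊛ inv f ≗ one
  inv-inverseʳ f f₀≡1 m = begin
    (f ⊛ inv f) m                          ≡⟨ ⊛-local f≗1⊖g inv≗geometric m ℕₚ.≤-refl ⟩
    ((one ⊖ g) ⊛ geometric g (suc m)) m    ≡⟨ geometric-telescope g (suc m) m ⟩
    one m - pow g (suc m) m                ≡⟨ cong (λ x → one m - x) (pow-order g≗0 (suc m) m ℕₚ.≤-refl) ⟩
    one m - 0ℤ                             ≡⟨ ℤₚ.+-identityʳ (one m) ⟩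
    one m                                  ∎
    where
    open ≡-Reasoning
    g = one ⊖ f
    g≗0 : g ≗[ 1 ] 𝟘
    g≗0 zero    _           = cong (λ x → 1ℤ - x) f₀≡1
    g≗0 (suc _) (s≤s ())
    f≗1⊖g : f ≗[ suc m ] one ⊖ g
    f≗1⊖g = ≗⇒≗[] (suc m) (solve 1 (λ f → f := I :- (I :- f)) ≗-refl f)
    inv≗geometric : inv f ≗[ suc m ] geometric g (suc m)
    inv≗geometric i i≤m = sym (sumBelow-extend _ i≤m (λ r i<r _ → pow-order g≗0 r i i<r))

  inv-inverseˡ : ∀ f → f 0 ≡ 1ℤ → inv f ⊛ f ≗ one
  inv-inverseˡ f f₀≡1 = ≗-trans (⊛-comm (inv f) f) (inv-inverseʳ f f₀≡1)

  inv-unique : ∀ f h → f 0 ≡ 1ℤ → f ⊛ h ≗ one → h ≗ inv f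
  inv-unique f h f₀≡1 fh≗1 = begin
    h                  ≈⟨ ⊛-identityˡ h ⟨
    one ⊛ h            ≈⟨ ⊛-congʳ h (inv-inverseˡ f f₀≡1) ⟨
    (inv f ⊛ f) ⊛ h    ≈⟨ ⊛-assoc (inv f) f h ⟩
    inv f ⊛ (f ⊛ h)    ≈⟨ ⊛-congˡ (inv f) fh≗1 ⟩
    inv f ⊛ one        ≈⟨ ⊛-identityʳ (inv f) ⟩
    inv f              ∎
    where open ≗-Reasoning

  inv-local : ∀ {f g a} → f ≗[ a ] g → inv f ≗[ a ] inv g
  inv-local f≗g m m<a = sumBelow-cong (suc m) (λ r _ →
    pow-local r (⊖-local (≗[]-refl one) f≗g) m m<a)

  inv-cong : ∀ {f g} → f ≗ g → inv f ≗ inv g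
  inv-cong f≗g = ≗[]⇒≗ (λ a → inv-local (≗⇒≗[] a f≗g))

  inv-one : inv one ≗ one
  inv-one = ≗-sym (inv-unique one one refl (⊛-identityˡ one))

  inv-≗[]one : ∀ {f a} → f ≗[ a ] one → inv f ≗[ a ] one
  inv-≗[]one {a = a} f≗1 = ≗[]-trans (inv-local f≗1) (≗⇒≗[] a inv-one)

  ⊛-constant : ∀ f g → (f ⊛ g) 0 ≡ f 0 * g 0
  ⊛-constant f g = ℤₚ.+-identityˡ (f 0 * g 0)

  inv-⊛ : ∀ f g → f 0 ≡ 1ℤ → g 0 ≡ 1ℤ → inv (f ⊛ g) ≗ inv f ⊛ inv g
  inv-⊛ f g f₀≡1 g₀≡1 = ≗-sym (inv-unique (f ⊛ g) (inv f ⊛ inv g) fg₀≡1 (begin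
    (f ⊛ g) ⊛ (inv f ⊛ inv g)      ≈⟨ solve 4 (λ f g f⁻¹ g⁻¹ → (f :* g) :* (f⁻¹ :* g⁻¹) := (f :* f⁻¹) :* (g :* g⁻¹))
                                            ≗-refl f g (inv f) (inv g) ⟩
    (f ⊛ inv f) ⊛ (g ⊛ inv g)      ≈⟨ ⊛-cong (inv-inverseʳ f f₀≡1) (inv-inverseʳ g g₀≡1) ⟩
    one ⊛ one                      ≈⟨ ⊛-identityˡ one ⟩
    one                            ∎))
    where
    open ≗-Reasoning
    fg₀≡1 : (f ⊛ g) 0 ≡ 1ℤ
    fg₀≡1 = trans (⊛-constant f g) (cong₂ _*_ f₀≡1 g₀≡1)

  inv-square : ∀ f → f 0 ≡ 1ℤ → inv (pow f 2) ≗ inv f ⊛ inv f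
  inv-square f f₀≡1 = ≗-trans (inv-cong (⊛-congˡ f (⊛-identityʳ f))) (inv-⊛ f f f₀≡1 f₀≡1)

  inv-step : ∀ f g c → f 0 ≡ 1ℤ → g 0 ≡ 1ℤ → f ≗ c ⊛ g → inv g ≗ c ⊛ inv f
  inv-step f g c f₀≡1 g₀≡1 f≗cg = ≗-sym (inv-unique g (c ⊛ inv f) g₀≡1 (begin
    g ⊛ (c ⊛ inv f)    ≈⟨ solve 3 (λ g c f⁻¹ → g :* (c :* f⁻¹) := (c :* g) :* f⁻¹) ≗-refl g c (inv f) ⟩
    (c ⊛ g) ⊛ inv f    ≈⟨ ⊛-congʳ (inv f) f≗cg ⟨
    f ⊛ inv f          ≈⟨ inv-inverseʳ f f₀≡1 ⟩
    one                ∎))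
    where open ≗-Reasoning

  ⊛-cancelˡ : ∀ f {g h a} → f 0 ≡ 1ℤ → f ⊛ g ≗[ a ] f ⊛ h → g ≗[ a ] h
  ⊛-cancelˡ f {g} {h} {a} f₀≡1 fg≗fh = begin
    g                ≈⟨ ≗⇒≗[] a (undo g) ⟩
    inv f ⊛ (f ⊛ g)  ≈⟨ ⊛-local (≗[]-refl (inv f)) fg≗fh ⟩
    inv f ⊛ (f ⊛ h)  ≈⟨ ≗⇒≗[] a (undo h) ⟨
    h                ∎
    where
    open ≗[]-Reasoning a
    undo : ∀ x → x ≗ inv f ⊛ (f ⊛ x)
    undo x = ≗-trans (≗-sym (⊛-identityˡ x))
                     (≗-trans (⊛-congʳ x (≗-sym (inv-inverseˡ f f₀≡1))) (⊛-assoc (inv f) f x))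

  -- Infinite sums

  -- sumSeries t is the genuine sum of the family t when its n-th term is ≡ 0 (mod qⁿ).
  Summable : (ℕ → Series) → Set
  Summable t = ∀ n → t n ≗[ n ] 𝟘

  sumSeries-cong : ∀ {t u} → (∀ n → t n ≗ u n) → sumSeries t ≗ sumSeries u
  sumSeries-cong t≗u m = sumBelow-cong (suc m) (λ n _ → t≗u n m)

  sumSeries-local : ∀ {t u a} → (∀ n → t n ≗[ a ] u n) → sumSeries t ≗[ a ] sumSeries u
  sumSeries-local t≗u m m<a = sumBelow-cong (suc m) (λ n _ → t≗u n m m<a)

  sumSeries-⊖ : ∀ t u → sumSeries (λ n → t n ⊖ u n) ≗ sumSeries t ⊖ sumSeries u
  sumSeries-⊖ t u m = sumBelow-- (suc m) (λ n → t n m) (λ n → u n m)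

  sumSeries-⊛ : ∀ c t → Summable t → c ⊛ sumSeries t ≗ sumSeries (λ n → c ⊛ t n)
  sumSeries-⊛ c t t-summable m = begin
    sumBelow (suc m) (λ i → c i * sumBelow (suc (m ∸ i)) (λ n → t n (m ∸ i)))
      ≡⟨ sumBelow-cong (suc m) (λ i _ → cong (c i *_) (sym (sumBelow-extend _ (s≤s (ℕₚ.m∸n≤m m i))
                                          (λ n m∸i<n _ → t-summable n (m ∸ i) m∸i<n)))) ⟩
    sumBelow (suc m) (λ i → c i * sumBelow (suc m) (λ n → t n (m ∸ i)))
      ≡⟨ sumBelow-cong (suc m) (λ i _ → sumBelow-*ˡ (suc m) (c i) _) ⟩
    sumBelow (suc m) (λ i → sumBelow (suc m) (λ n → c i * t n (m ∸ i)))
      ≡⟨ sumBelow-swap (suc m) (suc m) _ ⟩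
    sumBelow (suc m) (λ n → sumBelow (suc m) (λ i → c i * t n (m ∸ i)))
      ∎
    where open ≡-Reasoning

  sumSeries-telescope : ∀ e → Summable e → sumSeries (λ n → e n ⊖ e (suc n)) ≗ e 0
  sumSeries-telescope e e-summable m = begin
    sumSeries (λ n → e n ⊖ e (suc n)) m  ≡⟨ sumBelow-telescope (suc m) (λ n → e n m) ⟩
    e 0 m - e (suc m) m                  ≡⟨ cong (λ x → e 0 m - x) (e-summable (suc m) m ℕₚ.≤-refl) ⟩
    e 0 m - 0ℤ                           ≡⟨ ℤₚ.+-identityʳ (e 0 m) ⟩
    e 0 m                                ∎
    where open ≡-Reasoning

  sumSeries-telescoping : ∀ c d {u v} e → Summable u → Summable v → Summable e →
    (∀ n → c ⊛ u n ⊖ d ⊛ v n ≗ e n ⊖ e (suc n)) → c ⊛ sumSeries u ⊖ d ⊛ sumSeries v ≗ e 0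
  sumSeries-telescoping c d {u} {v} e u-summable v-summable e-summable term≗ = begin
    c ⊛ sumSeries u ⊖ d ⊛ sumSeries v
      ≈⟨ ⊖-cong (sumSeries-⊛ c u u-summable) (sumSeries-⊛ d v v-summable) ⟩
    sumSeries (λ n → c ⊛ u n) ⊖ sumSeries (λ n → d ⊛ v n)
      ≈⟨ sumSeries-⊖ (λ n → c ⊛ u n) (λ n → d ⊛ v n) ⟨
    sumSeries (λ n → c ⊛ u n ⊖ d ⊛ v n)
      ≈⟨ sumSeries-cong term≗ ⟩
    sumSeries (λ n → e n ⊖ e (suc n))
      ≈⟨ sumSeries-telescope e e-summable ⟩
    e 0 ∎
    where open ≗-Reasoning

open FormalPowerSeries
open import Data.Nat using (_+_; _*_; NonZero)
open import Data.Nat.Tactic.RingSolver using (solve-∀)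

-- q-Pochhammer symbols

+-*-suc : ∀ a d n → a + d * suc n ≡ a + d + d * n
+-*-suc a d n = trans (cong (a +_) (ℕₚ.*-suc d n)) (sym (ℕₚ.+-assoc a d (d * n)))

poch-≗[]one : ∀ a d n → poch a d n ≗[ a ] one
poch-≗[]one a d zero    = ≗[]-refl one
poch-≗[]one a d (suc n) = ≗[]-trans
  (⊛-local (poch-≗[]one a d n) (≗[]-weaken (ℕₚ.m≤m+n a (d * n)) (one⊖qpow≗[]one (a + d * n))))
  (≗⇒≗[] a (⊛-identityˡ one))

poch-stable : ∀ a d {N} N′ → N ≤ N′ → poch a d N ≗[ a + d * N ] poch a d N′
poch-stable a d zero     z≤n       = ≗[]-refl one
poch-stable a d {N} (suc N′) N≤N′+1 with ℕₚ.m≤n⇒m<n∨m≡n N≤N′+1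
... | inj₂ refl       = ≗[]-refl (poch a d N)
... | inj₁ (s≤s N≤N′) = ≗[]-trans (poch-stable a d N′ N≤N′)
  (≗[]-sym (≗[]-weaken (ℕₚ.+-monoʳ-≤ a (ℕₚ.*-monoʳ-≤ d N≤N′))
    (⊛-≗[]oneʳ (poch a d N′) (one⊖qpow≗[]one (a + d * N′)))))

poch-uncons : ∀ a d n → poch a d (suc n) ≗ (one ⊖ qpow a) ⊛ poch (a + d) d n
poch-uncons a d zero = begin
  one ⊛ (one ⊖ qpow (a + d * 0))  ≈⟨ ⊛-identityˡ (one ⊖ qpow (a + d * 0)) ⟩
  one ⊖ qpow (a + d * 0)          ≡⟨ cong (λ e → one ⊖ qpow e) (trans (cong (a +_) (ℕₚ.*-zeroʳ d)) (ℕₚ.+-identityʳ a)) ⟩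
  one ⊖ qpow a                    ≈⟨ ⊛-identityʳ (one ⊖ qpow a) ⟨
  (one ⊖ qpow a) ⊛ one            ∎
  where open ≗-Reasoning
poch-uncons a d (suc n) = begin
  poch a d (suc n) ⊛ (one ⊖ qpow (a + d * suc n))
    ≈⟨ ⊛-congʳ (one ⊖ qpow (a + d * suc n)) (poch-uncons a d n) ⟩
  ((one ⊖ qpow a) ⊛ poch (a + d) d n) ⊛ (one ⊖ qpow (a + d * suc n))
    ≡⟨ cong (λ e → ((one ⊖ qpow a) ⊛ poch (a + d) d n) ⊛ (one ⊖ qpow e)) (+-*-suc a d n) ⟩
  ((one ⊖ qpow a) ⊛ poch (a + d) d n) ⊛ (one ⊖ qpow (a + d + d * n))
    ≈⟨ ⊛-assoc (one ⊖ qpow a) (poch (a + d) d n) (one ⊖ qpow (a + d + d * n)) ⟩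
  (one ⊖ qpow a) ⊛ poch (a + d) d (suc n) ∎
  where open ≗-Reasoning

poch-≗[]pochInf : ∀ a d .{{_ : NonZero d}} N → poch a d N ≗[ a + d * N ] pochInf a d
poch-≗[]pochInf a d N i i<a+dN with ℕₚ.≤-total N (suc i)
... | inj₁ N≤i+1 = poch-stable a d (suc i) N≤i+1 i i<a+dN
... | inj₂ i+1≤N = sym (poch-stable a d N i+1≤N i
                        (ℕₚ.≤-trans (ℕₚ.m≤n*m (suc i) d) (ℕₚ.m≤n+m (d * suc i) a)))

pochInf-≗[]one : ∀ a d → pochInf a d ≗[ a ] one
pochInf-≗[]one a d m = poch-≗[]one a d (suc m) m

pochInf-uncons : ∀ a d .{{_ : NonZero d}} → pochInf a d ≗ (one ⊖ qpow a) ⊛ pochInf (a + d) d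
pochInf-uncons a d m = trans (poch-uncons a d m m)
  (⊛-local (≗[]-refl (one ⊖ qpow a)) (≗[]-weaken m<a+d+dm (poch-≗[]pochInf (a + d) d m)) m ℕₚ.≤-refl)
  where
  m<a+d+dm : suc m ≤ a + d + d * m
  m<a+d+dm = subst (suc m ≤_) (+-*-suc a d m) (ℕₚ.≤-trans (ℕₚ.m≤n*m (suc m) d) (ℕₚ.m≤n+m (d * suc m) a))

poch⁻¹-snoc : ∀ a d n → 1 ≤ a → inv (poch a d n) ≗ (one ⊖ qpow (a + d * n)) ⊛ inv (poch a d (suc n))
poch⁻¹-snoc a d n 1≤a = inv-step (poch a d (suc n)) (poch a d n) (one ⊖ qpow (a + d * n))
  (poch-≗[]one a d (suc n) 0 1≤a) (poch-≗[]one a d n 0 1≤a) (⊛-comm (poch a d n) (one ⊖ qpow (a + d * n)))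

poch⁻¹-uncons : ∀ a d n → 1 ≤ a → inv (poch (a + d) d n) ≗ (one ⊖ qpow a) ⊛ inv (poch a d (suc n))
poch⁻¹-uncons a d n 1≤a = inv-step (poch a d (suc n)) (poch (a + d) d n) (one ⊖ qpow a)
  (poch-≗[]one a d (suc n) 0 1≤a) (poch-≗[]one (a + d) d n 0 (ℕₚ.≤-trans 1≤a (ℕₚ.m≤m+n a d)))
  (poch-uncons a d n)

P : ℕ → Series
P a = pochInf a 2

P⁻¹ : ℕ → Series
P⁻¹ a = inv (P a)

P-0 : P 0 ≗ 𝟘
P-0 = begin
  P 0                        ≈⟨ pochInf-uncons 0 2 ⟩
  (one ⊖ qpow 0) ⊛ P 2       ≈⟨ ⊛-congʳ (P 2) (≗-trans (⊖-cong (≗-refl {one}) qpow-0) (λ m → ℤₚ.+-inverseʳ (one m))) ⟩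
  𝟘 ⊛ P 2                    ≈⟨ ⊛-zeroˡ (P 2) ⟩
  𝟘                          ∎
  where open ≗-Reasoning

P⁻¹-≗[]one : ∀ a → P⁻¹ a ≗[ a ] one
P⁻¹-≗[]one a = inv-≗[]one (pochInf-≗[]one a 2)

P⁻¹-uncons : ∀ a → 1 ≤ a → P⁻¹ (a + 2) ≗ (one ⊖ qpow a) ⊛ P⁻¹ a
P⁻¹-uncons a 1≤a = inv-step (P a) (P (a + 2)) (one ⊖ qpow a)
  (pochInf-≗[]one a 2 0 1≤a) (pochInf-≗[]one (a + 2) 2 0 (ℕₚ.≤-trans 1≤a (ℕₚ.m≤m+n a 2)))
  (pochInf-uncons a 2)

-- A first-order recurrence in s

Recurrence : (ℕ → Series) → Set
Recurrence X = ∀ s → 1 ≤ s → (one ⊖ qpow s) ⊛ X s ≗ one ⊕ qpow 1 ⊛ X (s + 2)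

recurrence-unique : ∀ {X Y} → Recurrence X → Recurrence Y → ∀ s → 1 ≤ s → X s ≗ Y s
recurrence-unique {X} {Y} X-rec Y-rec s 1≤s = ≗[]⇒≗ (λ c → agree c s 1≤s)
  where
  agree : ∀ c s → 1 ≤ s → X s ≗[ c ] Y s
  agree zero    s _   = λ _ ()
  agree (suc c) s 1≤s = ⊛-cancelˡ (one ⊖ qpow s) (one⊖qpow≗[]one s 0 1≤s) (begin
    (one ⊖ qpow s) ⊛ X s      ≈⟨ ≗⇒≗[] (suc c) (X-rec s 1≤s) ⟩
    one ⊕ qpow 1 ⊛ X (s + 2)  ≈⟨ ⊕-local (≗[]-refl one) (qpow-⊛-local 1 (agree c (s + 2) 1≤s+2)) ⟩
    one ⊕ qpow 1 ⊛ Y (s + 2)  ≈⟨ ≗⇒≗[] (suc c) (Y-rec s 1≤s) ⟨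
    (one ⊖ qpow s) ⊛ Y s      ∎)
    where
    open ≗[]-Reasoning (suc c)
    1≤s+2 : 1 ≤ s + 2
    1≤s+2 = ℕₚ.≤-trans 1≤s (ℕₚ.m≤m+n s 2)

telescoping-recurrence : ∀ (t e : ℕ → ℕ → Series) → (∀ s → Summable (t s)) → (∀ s → Summable (e s)) →
  (∀ s → e s 0 ≗ one) →
  (∀ s n → 1 ≤ s → (one ⊖ qpow s) ⊛ t s n ⊖ qpow 1 ⊛ t (s + 2) n ≗ e s n ⊖ e s (suc n)) →
  Recurrence (λ s → sumSeries (t s))
telescoping-recurrence t e t-summable e-summable e₀≗1 telescopes s 1≤s = begin
  (one ⊖ qpow s) ⊛ T s
    ≈⟨ solve 2 (λ x y → x := (x :- y) :+ y) ≗-refl ((one ⊖ qpow s) ⊛ T s) (qpow 1 ⊛ T (s + 2)) ⟩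
  ((one ⊖ qpow s) ⊛ T s ⊖ qpow 1 ⊛ T (s + 2)) ⊕ qpow 1 ⊛ T (s + 2)
    ≈⟨ ⊕-cong (sumSeries-telescoping (one ⊖ qpow s) (qpow 1) (e s) (t-summable s) (t-summable (s + 2))
                                      (e-summable s) (λ n → telescopes s n 1≤s)) ≗-refl ⟩
  e s 0 ⊕ qpow 1 ⊛ T (s + 2)
    ≈⟨ ⊕-cong (e₀≗1 s) ≗-refl ⟩
  one ⊕ qpow 1 ⊛ T (s + 2) ∎
  where
  open ≗-Reasoning
  T : ℕ → Series
  T s = sumSeries (t s)

Ω-term : ℕ → ℕ → Series
Ω-term s n = qpow (n * suc (s + 2 * n)) ⊛ (inv (poch 1 2 (suc n)) ⊛ inv (poch s 2 (suc n)))

Ω : ℕ → Series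
Ω s = sumSeries (Ω-term s)

Ω-term-summable : ∀ s → Summable (Ω-term s)
Ω-term-summable s n = ≗[]-weaken (ℕₚ.m≤m*n n (suc (s + 2 * n)))
  (qpow-⊛-order _ (inv (poch 1 2 (suc n)) ⊛ inv (poch s 2 (suc n))))

Ω-telescope : ℕ → ℕ → Series
Ω-telescope s n = qpow (n * suc (s + 2 * n)) ⊛ (inv (poch 1 2 n) ⊛ inv (poch (s + 2) 2 n))

Ω-telescope-summable : ∀ s → Summable (Ω-telescope s)
Ω-telescope-summable s n =
  ≗[]-weaken (ℕₚ.m≤m*n n (suc (s + 2 * n))) (qpow-⊛-order _ (inv (poch 1 2 n) ⊛ inv (poch (s + 2) 2 n)))

Ω-telescope₀≗1 : ∀ s → Ω-telescope s 0 ≗ one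
Ω-telescope₀≗1 s = ≗-trans (⊛-cong qpow-0 (⊛-cong inv-one inv-one))
                           (≗-trans (⊛-identityˡ (one ⊛ one)) (⊛-identityˡ one))

Ω-term-telescopes : ∀ s n → 1 ≤ s →
  (one ⊖ qpow s) ⊛ Ω-term s n ⊖ qpow 1 ⊛ Ω-term (s + 2) n ≗ Ω-telescope s n ⊖ Ω-telescope s (suc n)
Ω-term-telescopes s n 1≤s = begin
  (one ⊖ qpow s) ⊛ (Q ⊛ (V ⊛ W)) ⊖ qpow 1 ⊛ (Q′ ⊛ (V ⊛ W′))
    ≈⟨ solve 7 (λ y Q V W q Q′ W′ → (I :- y) :* (Q :* (V :* W)) :- q :* (Q′ :* (V :* W′))
                                     := Q :* (V :* ((I :- y) :* W)) :- (q :* Q′) :* (V :* W′))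
             ≗-refl (qpow s) Q V W (qpow 1) Q′ W′ ⟩
  Q ⊛ (V ⊛ ((one ⊖ qpow s) ⊛ W)) ⊖ (qpow 1 ⊛ Q′) ⊛ (V ⊛ W′)
    ≈⟨ ⊖-cong (⊛-congˡ Q (⊛-congˡ V W-step)) (⊛-congʳ (V ⊛ W′) Q′-step) ⟩
  Q ⊛ (V ⊛ ((one ⊖ b) ⊛ W′)) ⊖ (Q ⊛ a) ⊛ (V ⊛ W′)
    ≈⟨ solve 5 (λ Q V a b W′ → Q :* (V :* ((I :- b) :* W′)) :- (Q :* a) :* (V :* W′)
                               := Q :* (((I :- a) :* V) :* ((I :- b) :* W′)) :- (Q :* a :* b) :* (V :* W′))
             ≗-refl Q V a b W′ ⟩
  Q ⊛ (((one ⊖ a) ⊛ V) ⊛ ((one ⊖ b) ⊛ W′)) ⊖ (Q ⊛ a ⊛ b) ⊛ (V ⊛ W′)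
    ≈⟨ ⊖-cong (⊛-congˡ Q (⊛-cong (poch⁻¹-snoc 1 2 n ℕₚ.≤-refl) (poch⁻¹-snoc (s + 2) 2 n 1≤s+2)))
              (⊛-congʳ (V ⊛ W′) Q-next) ⟨
  Ω-telescope s n ⊖ Ω-telescope s (suc n) ∎
  where
  open ≗-Reasoning
  Q  = qpow (n * suc (s + 2 * n))
  Q′ = qpow (n * suc (s + 2 + 2 * n))
  V  = inv (poch 1 2 (suc n))
  W  = inv (poch s 2 (suc n))
  W′ = inv (poch (s + 2) 2 (suc n))
  a  = qpow (1 + 2 * n)
  b  = qpow (s + 2 + 2 * n)
  1≤s+2 : 1 ≤ s + 2
  1≤s+2 = ℕₚ.≤-trans 1≤s (ℕₚ.m≤m+n s 2)
  W-step : (one ⊖ qpow s) ⊛ W ≗ (one ⊖ b) ⊛ W′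
  W-step = ≗-trans (≗-sym (poch⁻¹-uncons s 2 n 1≤s)) (poch⁻¹-snoc (s + 2) 2 n 1≤s+2)
  exponent-step : ∀ s n → 1 + n * suc (s + 2 + 2 * n) ≡ n * suc (s + 2 * n) + (1 + 2 * n)
  exponent-step = solve-∀
  exponent-next : ∀ s n → suc n * suc (s + 2 * suc n) ≡ n * suc (s + 2 * n) + (1 + 2 * n) + (s + 2 + 2 * n)
  exponent-next = solve-∀
  Q′-step : qpow 1 ⊛ Q′ ≗ Q ⊛ a
  Q′-step = begin
    qpow 1 ⊛ Q′                               ≈⟨ qpow-+ 1 _ ⟩
    qpow (1 + n * suc (s + 2 + 2 * n))        ≡⟨ cong qpow (exponent-step s n) ⟩
    qpow (n * suc (s + 2 * n) + (1 + 2 * n))  ≈⟨ qpow-+ _ (1 + 2 * n) ⟨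
    Q ⊛ a                                     ∎
  Q-next : qpow (suc n * suc (s + 2 * suc n)) ≗ Q ⊛ a ⊛ b
  Q-next = begin
    qpow (suc n * suc (s + 2 * suc n))                          ≡⟨ cong qpow (exponent-next s n) ⟩
    qpow (n * suc (s + 2 * n) + (1 + 2 * n) + (s + 2 + 2 * n))  ≈⟨ qpow-+ _ (s + 2 + 2 * n) ⟨
    qpow (n * suc (s + 2 * n) + (1 + 2 * n)) ⊛ b                ≈⟨ ⊛-congʳ b (qpow-+ _ (1 + 2 * n)) ⟨
    Q ⊛ a ⊛ b                                                   ∎

Ω-recurrence : Recurrence Ω
Ω-recurrence = telescoping-recurrence Ω-term Ω-telescope Ω-term-summable Ω-telescope-summable
  Ω-telescope₀≗1 Ω-term-telescopes

K-term : ℕ → ℕ → Series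
K-term s n = qpow (2 * n) ⊛ (P (2 * n + 2) ⊛ (P⁻¹ (2 * n + 1) ⊛ P⁻¹ (2 * n + s)))

K : ℕ → Series
K s = sumSeries (K-term s)

K-term-summable : ∀ s → Summable (K-term s)
K-term-summable s n = ≗[]-weaken (ℕₚ.m≤n*m n 2)
  (qpow-⊛-order (2 * n) (P (2 * n + 2) ⊛ (P⁻¹ (2 * n + 1) ⊛ P⁻¹ (2 * n + s))))

K-telescope : ℕ → ℕ → Series
K-telescope s n = one ⊖ P (2 * n) ⊛ (P⁻¹ (2 * n + 1) ⊛ P⁻¹ (2 * n + s))

K-telescope-summable : ∀ s → Summable (K-telescope s)
K-telescope-summable s n = ≗[]-weaken (ℕₚ.m≤n*m n 2)
  (≗[]-trans (⊖-local (≗[]-refl one) product≗1) (≗⇒≗[] (2 * n) (λ m → ℤₚ.+-inverseʳ (one m))))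
  where
  product≗1 : P (2 * n) ⊛ (P⁻¹ (2 * n + 1) ⊛ P⁻¹ (2 * n + s)) ≗[ 2 * n ] one
  product≗1 = ≗[]-trans
    (⊛-local (pochInf-≗[]one (2 * n) 2)
             (⊛-local (≗[]-weaken (ℕₚ.m≤m+n (2 * n) 1) (P⁻¹-≗[]one (2 * n + 1)))
                      (≗[]-weaken (ℕₚ.m≤m+n (2 * n) s) (P⁻¹-≗[]one (2 * n + s)))))
    (≗⇒≗[] (2 * n) (≗-trans (⊛-identityˡ (one ⊛ one)) (⊛-identityˡ one)))

K-telescope₀≗1 : ∀ s → K-telescope s 0 ≗ one
K-telescope₀≗1 s =
  ≗-trans (⊖-cong (≗-refl {one}) (≗-trans (⊛-congʳ R P-0) (⊛-zeroˡ R))) (λ m → ℤₚ.+-identityʳ (one m))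
  where R = P⁻¹ 1 ⊛ P⁻¹ s

K-term-telescopes : ∀ s n → 1 ≤ s →
  (one ⊖ qpow s) ⊛ K-term s n ⊖ qpow 1 ⊛ K-term (s + 2) n ≗ K-telescope s n ⊖ K-telescope s (suc n)
K-term-telescopes s n 1≤s = begin
  (one ⊖ y) ⊛ (x ⊛ (N ⊛ (A ⊛ B))) ⊖ z ⊛ (x ⊛ (N ⊛ (A ⊛ P⁻¹ (2 * n + (s + 2)))))
    ≈⟨ ⊖-cong (≗-refl {(one ⊖ y) ⊛ K-term s n})
              (⊛-congˡ z (⊛-congˡ x (⊛-congˡ N (⊛-congˡ A (P⁻¹-step s 2n+s≥1 (assoc-2 s)))))) ⟩
  (one ⊖ y) ⊛ (x ⊛ (N ⊛ (A ⊛ B))) ⊖ z ⊛ (x ⊛ (N ⊛ (A ⊛ ((one ⊖ x ⊛ y) ⊛ B))))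
    ≈⟨ solve 6 (λ x y z N A B →
                 (I :- y) :* (x :* (N :* (A :* B))) :- z :* (x :* (N :* (A :* ((I :- x :* y) :* B))))
              := (I :- ((I :- x) :* N) :* (A :* B)) :- (I :- N :* (((I :- x :* z) :* A) :* ((I :- x :* y) :* B))))
             ≗-refl x y z N A B ⟩
  (one ⊖ ((one ⊖ x) ⊛ N) ⊛ (A ⊛ B)) ⊖ (one ⊖ N ⊛ (((one ⊖ x ⊛ z) ⊛ A) ⊛ ((one ⊖ x ⊛ y) ⊛ B)))
    ≈⟨ ⊖-cong (⊖-cong (≗-refl {one}) (⊛-congʳ (A ⊛ B) (pochInf-uncons (2 * n) 2)))
              (⊖-cong (≗-refl {one}) (⊛-cong (λ m → cong (λ c → P c m) (double-suc n))
                                               (⊛-cong (P⁻¹-step 1 (ℕₚ.m≤n+m 1 (2 * n)) (double-suc-+ 1 n))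
                                                       (P⁻¹-step s 2n+s≥1 (double-suc-+ s n))))) ⟨
  K-telescope s n ⊖ K-telescope s (suc n) ∎
  where
  open ≗-Reasoning
  x = qpow (2 * n)
  y = qpow s
  z = qpow 1
  N = P (2 * n + 2)
  A = P⁻¹ (2 * n + 1)
  B = P⁻¹ (2 * n + s)
  2n+s≥1 : 1 ≤ 2 * n + s
  2n+s≥1 = ℕₚ.≤-trans 1≤s (ℕₚ.m≤n+m s (2 * n))
  P⁻¹-step : ∀ b → 1 ≤ 2 * n + b → ∀ {c} → c ≡ 2 * n + b + 2 → P⁻¹ c ≗ (one ⊖ x ⊛ qpow b) ⊛ P⁻¹ (2 * n + b)
  P⁻¹-step b 2n+b≥1 refl = ≗-trans (P⁻¹-uncons (2 * n + b) 2n+b≥1)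
    (⊛-congʳ (P⁻¹ (2 * n + b)) (⊖-cong (≗-refl {one}) (≗-sym (qpow-+ (2 * n) b))))
  assoc-2 : ∀ s → 2 * n + (s + 2) ≡ 2 * n + s + 2
  assoc-2 s = sym (ℕₚ.+-assoc (2 * n) s 2)
  double-suc : ∀ n → 2 * suc n ≡ 2 * n + 2
  double-suc = solve-∀
  double-suc-+ : ∀ b n → 2 * suc n + b ≡ 2 * n + b + 2
  double-suc-+ = solve-∀

K-recurrence : Recurrence K
K-recurrence = telescoping-recurrence K-term K-telescope K-term-summable K-telescope-summable K-telescope₀≗1
  K-term-telescopes

K≗Ω : ∀ s → 1 ≤ s → K s ≗ Ω s
K≗Ω = recurrence-unique K-recurrence Ω-recurrence

ω≗Ω1 : ω ≗ Ω 1
ω≗Ω1 = sumSeries-cong (λ n → ⊛-cong (λ m → cong (λ e → qpow e m) (exponent n)) (begin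
  inv (pow (poch 1 2 (n + 1)) 2)                   ≡⟨ cong (λ k → inv (pow (poch 1 2 k) 2)) (ℕₚ.+-comm n 1) ⟩
  inv (pow (poch 1 2 (suc n)) 2)                   ≈⟨ inv-square (poch 1 2 (suc n)) (poch-≗[]one 1 2 (suc n) 0 ℕₚ.≤-refl) ⟩
  inv (poch 1 2 (suc n)) ⊛ inv (poch 1 2 (suc n))  ∎))
  where
  open ≗-Reasoning
  exponent : ∀ n → 2 * n * (n + 1) ≡ n * suc (1 + 2 * n)
  exponent = solve-∀

F-term≗[]q⊛K-term : ∀ k n → P (2 * n + 2) ⊛ P (2 * n + 2 * k) ⊛ inv (pow (P (2 * n + 1)) 2) ⊛ qpow (2 * n + 1)
                              ≗[ 1 + 2 * k ] qpow 1 ⊛ K-term 1 n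
F-term≗[]q⊛K-term k n = let open ≗[]-Reasoning (2 * n + 1 + (2 * n + 2 * k)) in ≗[]-weaken bound (begin
  N ⊛ B ⊛ inv (pow (P (2 * n + 1)) 2) ⊛ qpow (2 * n + 1)  ≈⟨ ≗⇒≗[] _ regroup ⟩
  qpow (2 * n + 1) ⊛ (R ⊛ B)                              ≈⟨ qpow-⊛-local (2 * n + 1) (⊛-≗[]oneʳ R B≗[]1) ⟩
  qpow (2 * n + 1) ⊛ R                                    ≈⟨ ≗⇒≗[] _ finish ⟩
  qpow 1 ⊛ K-term 1 n                                     ∎)
  where
  N = P (2 * n + 2)
  A = P⁻¹ (2 * n + 1)
  B = P (2 * n + 2 * k)
  R = N ⊛ (A ⊛ A)
  B≗[]1 : B ≗[ 2 * n + 2 * k ] one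
  B≗[]1 = pochInf-≗[]one (2 * n + 2 * k) 2
  regroup : N ⊛ B ⊛ inv (pow (P (2 * n + 1)) 2) ⊛ qpow (2 * n + 1) ≗ qpow (2 * n + 1) ⊛ (R ⊛ B)
  regroup = begin
    N ⊛ B ⊛ inv (pow (P (2 * n + 1)) 2) ⊛ qpow (2 * n + 1)
      ≈⟨ ⊛-congʳ (qpow (2 * n + 1)) (⊛-congˡ (N ⊛ B)
           (inv-square (P (2 * n + 1)) (pochInf-≗[]one (2 * n + 1) 2 0 (ℕₚ.m≤n+m 1 (2 * n))))) ⟩
    N ⊛ B ⊛ (A ⊛ A) ⊛ qpow (2 * n + 1)
      ≈⟨ solve 4 (λ N B A q → N :* B :* (A :* A) :* q := q :* (N :* (A :* A) :* B)) ≗-refl N B A (qpow (2 * n + 1)) ⟩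
    qpow (2 * n + 1) ⊛ (R ⊛ B) ∎
    where open ≗-Reasoning
  finish : qpow (2 * n + 1) ⊛ R ≗ qpow 1 ⊛ K-term 1 n
  finish = begin
    qpow (2 * n + 1) ⊛ R         ≡⟨ cong (λ e → qpow e ⊛ R) (ℕₚ.+-comm (2 * n) 1) ⟩
    qpow (1 + 2 * n) ⊛ R         ≈⟨ ⊛-congʳ R (qpow-+ 1 (2 * n)) ⟨
    (qpow 1 ⊛ qpow (2 * n)) ⊛ R  ≈⟨ ⊛-assoc (qpow 1) (qpow (2 * n)) R ⟩
    qpow 1 ⊛ K-term 1 n          ∎
    where open ≗-Reasoning
  bound : 1 + 2 * k ≤ 2 * n + 1 + (2 * n + 2 * k)
  bound = subst (1 + 2 * k ≤_) (sym (rearrange n k)) (ℕₚ.m≤m+n (1 + 2 * k) (4 * n))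
    where
    rearrange : ∀ n k → 2 * n + 1 + (2 * n + 2 * k) ≡ 1 + 2 * k + 4 * n
    rearrange = solve-∀

F≗[]q⊛K1 : ∀ k → F k ≗[ 1 + 2 * k ] qpow 1 ⊛ K 1
F≗[]q⊛K1 k = ≗[]-trans (sumSeries-local (F-term≗[]q⊛K-term k))
  (≗⇒≗[] (1 + 2 * k) (≗-sym (sumSeries-⊛ (qpow 1) (K-term 1) (K-term-summable 1))))

corollary1p6 : (k : ℕ) → 1 ≤ k → (m : ℕ) → 1 ≤ m → m ≤ 2 * k →
    coeff (qpow 1 ⊛ ω ⊖ F k) m ≡ 0ℤ
corollary1p6 k _ m _ m≤2k = ℤₚ.i≡j⇒i-j≡0 (begin
  (qpow 1 ⊛ ω) m    ≡⟨ ⊛-congˡ (qpow 1) (≗-trans ω≗Ω1 (≗-sym (K≗Ω 1 ℕₚ.≤-refl))) m ⟩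
  (qpow 1 ⊛ K 1) m  ≡⟨ F≗[]q⊛K1 k m (s≤s m≤2k) ⟨
  F k m             ∎)
  where open ≡-Reasoning
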